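{- Let $n\geq 2$ and let $P_n(AB)$ be the path on $n$ vertices with endpoints $A$ and $B$. Then the sages win the hat guessing game on $P_n(AB)$ with the hint $A\ne B$, and they also win with the hint $A=B$.
   Context: Hat guessing game: a sage sits at each vertex of a finite graph; hat colors are $H=\{0,1,2\}$; each sage sees only his neighbours' hats and guesses his own color by a deterministic function of the neighbours' colors, fixed in advance and known to everyone. Hint $A\neq B$: it is known in advance that the hats of $A$ and $B$ have different colors; the sages win with this hint if there is a strategy such that for every hat placement $C$ with $C(A)\ne C(B)$ at least one sage guesses correctly. Hint $A=B$: analogously, only placements with $C(A)=C(B)$ are considered. -}

module Defs where

open import Data.Nat using (ℕ; suc)
open import Data.Fin using (Fin; toℕ)
open import Data.Product using (Σ; ∃; _×_; _,_; proj₁)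
open import Data.Sum using (_⊎_)
open import Relation.Binary.PropositionalEquality using (_≡_; _≢_)

H : Set
H = Fin 3

record Graph (n : ℕ) : Set₁ where
  field
    Adj : Fin n → Fin n → Set

Path : (n : ℕ) → Graph n
Path n = record { Adj = λ i j → (toℕ j ≡ suc (toℕ i)) ⊎ (toℕ i ≡ suc (toℕ j)) }

Nbr : ∀ {n} → Graph n → Fin n → Set
Nbr {n} G v = Σ (Fin n) (λ u → Graph.Adj G v u)

Placement : ℕ → Set
Placement n = Fin n → H

Strategy : ∀ {n} → Graph n → Set
Strategy G = (v : _) → (Nbr G v → H) → H

guess : ∀ {n} (G : Graph n) → Strategy G → Placement n → Fin n → H
guess G f C v = f v (λ u → C (proj₁ u))

SomeoneCorrect : ∀ {n} (G : Graph n) → Strategy G → Placement n → Set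
SomeoneCorrect G f C = ∃ λ v → guess G f C v ≡ C v

WinsWithHintNeq : ∀ {n} → Graph n → Fin n → Fin n → Set
WinsWithHintNeq G A B =
  ∃ λ (f : Strategy G) → (C : Placement _) → C A ≢ C B → SomeoneCorrect G f C

WinsWithHintEq : ∀ {n} → Graph n → Fin n → Fin n → Set
WinsWithHintEq G A B =
  ∃ λ (f : Strategy G) → (C : Placement _) → C A ≡ C B → SomeoneCorrect G f C

-- If every sage of the path guesses wrong under the staircase strategy, the colours along the
-- path stay equal to the colour c₀ of A for a while and afterwards increase by 1 (mod 3) at
-- every step; the wrong guess of B then forces C(B) = c₀, so the hint A ≠ B cannot hold.
-- The hint A = B reduces to the hint A ≠ B: shifting the colour of B by 1 turns every
-- placement with C(A) = C(B) into one with C(A) ≠ C(B), and the sages can undo the shift.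
module Submission where

open import Defs
open import Data.Nat using (ℕ; suc)
open import Data.Fin using (Fin; zero; suc; fromℕ; inject₁)
open import Data.Fin.Properties using (toℕ-inject₁; _≟_; any?; 0≢1+n)
open import Data.Fin.Induction using (<-weakInduction)
open import Data.Fin.Relation.Unary.Top using (View; view; ‵fromℕ; ‵inject₁; view-fromℕ; view-inject₁)
open import Data.Product using (_×_; _,_; proj₁)
open import Data.Sum using (_⊎_; inj₁; inj₂)
open import Data.Empty using (⊥-elim)
open import Function using (id)
open import Relation.Nullary using (¬_; yes; no)
open import Relation.Nullary.Decidable using (decidable-stable)
open import Relation.Binary.PropositionalEquality

next : H → H
next zero = suc zero
next (suc zero) = suc (suc zero)
next (suc (suc zero)) = zero

next³≡id : ∀ x → next (next (next x)) ≡ x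
next³≡id zero = refl
next³≡id (suc zero) = refl
next³≡id (suc (suc zero)) = refl

x≢next-x : ∀ x → x ≢ next x
x≢next-x zero ()
x≢next-x (suc zero) ()
x≢next-x (suc (suc zero)) ()

next-trichotomy : ∀ a c → c ≡ a ⊎ c ≡ next a ⊎ c ≡ next (next a)
next-trichotomy zero zero = inj₁ refl
next-trichotomy zero (suc zero) = inj₂ (inj₁ refl)
next-trichotomy zero (suc (suc zero)) = inj₂ (inj₂ refl)
next-trichotomy (suc zero) zero = inj₂ (inj₂ refl)
next-trichotomy (suc zero) (suc zero) = inj₁ refl
next-trichotomy (suc zero) (suc (suc zero)) = inj₂ (inj₁ refl)
next-trichotomy (suc (suc zero)) zero = inj₂ (inj₁ refl)
next-trichotomy (suc (suc zero)) (suc zero) = inj₂ (inj₂ refl)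
next-trichotomy (suc (suc zero)) (suc (suc zero)) = inj₁ refl

Staircase : H → H → H → Set
Staircase c₀ a b = b ≡ next a ⊎ (a ≡ c₀ × b ≡ c₀)

-- The unique colour b for which Staircase c₀ a b can hold while Staircase c₀ b c fails.
midGuess : H → H → H
midGuess a c with c ≟ next (next a)
... | yes _ = a
... | no _  = next a

staircase-start : ∀ c₀ c₁ → next c₁ ≢ c₀ → Staircase c₀ c₀ c₁
staircase-start c₀ c₁ wrong with next-trichotomy c₀ c₁
... | inj₁ c₁≡c₀ = inj₂ (refl , c₁≡c₀)
... | inj₂ (inj₁ c₁≡c₀⁺) = inj₁ c₁≡c₀⁺
... | inj₂ (inj₂ c₁≡c₀⁺⁺) = ⊥-elim (wrong (trans (cong next c₁≡c₀⁺⁺) (next³≡id c₀)))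

staircase-step : ∀ {c₀ a b c} → Staircase c₀ a b → midGuess a c ≢ b → Staircase c₀ b c
staircase-step {a = a} {c = c} (inj₁ b≡a⁺) wrong with c ≟ next (next a)
... | yes c≡a⁺⁺ = inj₁ (trans c≡a⁺⁺ (cong next (sym b≡a⁺)))
... | no _ = ⊥-elim (wrong (sym b≡a⁺))
staircase-step {a = a} {c = c} (inj₂ (a≡c₀ , b≡c₀)) wrong with c ≟ next (next a)
... | yes _ = ⊥-elim (wrong (trans a≡c₀ (sym b≡c₀)))
... | no c≢a⁺⁺ with next-trichotomy a c
...   | inj₁ c≡a = inj₂ (b≡c₀ , trans c≡a a≡c₀)
...   | inj₂ (inj₁ c≡a⁺) = inj₁ (trans c≡a⁺ (cong next (trans a≡c₀ (sym b≡c₀))))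
...   | inj₂ (inj₂ c≡a⁺⁺) = ⊥-elim (c≢a⁺⁺ c≡a⁺⁺)

staircase-end : ∀ {c₀ a b} → Staircase c₀ a b → next a ≢ b → b ≡ c₀
staircase-end (inj₁ b≡a⁺) wrong = ⊥-elim (wrong (sym b≡a⁺))
staircase-end (inj₂ (_ , b≡c₀)) _ = b≡c₀

inject₁-adj-suc : ∀ {n} (i : Fin n) → Graph.Adj (Path (suc n)) (inject₁ i) (suc i)
inject₁-adj-suc i = inj₁ (cong suc (sym (toℕ-inject₁ i)))

suc-adj-inject₁ : ∀ {n} (i : Fin n) → Graph.Adj (Path (suc n)) (suc i) (inject₁ i)
suc-adj-inject₁ i = inj₂ (cong suc (sym (toℕ-inject₁ i)))

staircaseGuess : ∀ {m} {v : Fin (suc m)} → View v → (Nbr (Path (suc (suc m))) (suc v) → H) → H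
staircaseGuess ‵fromℕ see = next (see (inject₁ (fromℕ _) , suc-adj-inject₁ (fromℕ _)))
staircaseGuess (‵inject₁ u) see =
  midGuess (see (inject₁ (inject₁ u) , suc-adj-inject₁ (inject₁ u)))
           (see (suc (suc u) , inject₁-adj-suc (suc u)))

staircaseStrategy : ∀ m → Strategy (Path (suc (suc m)))
staircaseStrategy m zero see = next (see (suc zero , inject₁-adj-suc {suc m} zero))
staircaseStrategy m (suc v) see = staircaseGuess (view v) see

module _ (m : ℕ) (C : Placement (suc (suc m))) where

  private
    G = Path (suc (suc m))
    f = staircaseStrategy m

  guess-interior : (u : Fin m) →
    guess G f C (suc (inject₁ u)) ≡ midGuess (C (inject₁ (inject₁ u))) (C (suc (suc u)))
  guess-interior u = cong (λ w → staircaseGuess w (λ x → C (proj₁ x))) (view-inject₁ u)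

  guess-last : guess G f C (fromℕ (suc m)) ≡ next (C (inject₁ (fromℕ m)))
  guess-last = cong (λ w → staircaseGuess w (λ x → C (proj₁ x))) (view-fromℕ m)

  allWrong⇒staircase : (∀ v → guess G f C v ≢ C v) →
    (i : Fin (suc m)) → Staircase (C zero) (C (inject₁ i)) (C (suc i))
  allWrong⇒staircase wrong = <-weakInduction (λ i → Staircase (C zero) (C (inject₁ i)) (C (suc i)))
    (staircase-start (C zero) (C (suc zero)) (wrong zero))
    (λ u s → staircase-step s (λ e → wrong (suc (inject₁ u)) (trans (guess-interior u) e)))

  allWrong⇒endpointsEqual : (∀ v → guess G f C v ≢ C v) → C (fromℕ (suc m)) ≡ C zero
  allWrong⇒endpointsEqual wrong = staircase-end (allWrong⇒staircase wrong (fromℕ m))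
    (λ e → wrong (fromℕ (suc m)) (trans guess-last e))

someoneCorrect-by-contradiction : ∀ {n} (G : Graph n) (f : Strategy G) (C : Placement n) →
  ¬ (∀ v → guess G f C v ≢ C v) → SomeoneCorrect G f C
someoneCorrect-by-contradiction G f C notAllWrong =
  decidable-stable (any? (λ v → guess G f C v ≟ C v))
    (λ noneCorrect → notAllWrong (λ v e → noneCorrect (v , e)))

path-winsWithHintNeq : ∀ m → WinsWithHintNeq (Path (suc (suc m))) zero (fromℕ (suc m))
path-winsWithHintNeq m = staircaseStrategy m , λ C hint →
  someoneCorrect-by-contradiction _ (staircaseStrategy m) C (λ wrong → hint (sym (allWrong⇒endpointsEqual m C wrong)))

module _ {n} (G : Graph n) (σ σ⁻¹ : Fin n → H → H) (σ⁻¹∘σ : ∀ v x → σ⁻¹ v (σ v x) ≡ x) where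

  relabel : Placement n → Placement n
  relabel C v = σ v (C v)

  relabelStrategy : Strategy G → Strategy G
  relabelStrategy f v see = σ⁻¹ v (f v (λ u → σ (proj₁ u) (see u)))

  someoneCorrect-relabel : ∀ f C → SomeoneCorrect G f (relabel C) → SomeoneCorrect G (relabelStrategy f) C
  someoneCorrect-relabel f C (v , correct) = v , (begin
    σ⁻¹ v (guess G f (relabel C) v) ≡⟨ cong (σ⁻¹ v) correct ⟩
    σ⁻¹ v (σ v (C v))               ≡⟨ σ⁻¹∘σ v (C v) ⟩
    C v                             ∎)
    where open ≡-Reasoning

module _ {n} (B : Fin n) where

  nextAt : Fin n → H → H
  nextAt v with v ≟ B
  ... | yes _ = next
  ... | no _  = id

  prevAt : Fin n → H → H
  prevAt v with v ≟ B
  ... | yes _ = λ x → next (next x)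
  ... | no _  = id

  prevAt∘nextAt : ∀ v x → prevAt v (nextAt v x) ≡ x
  prevAt∘nextAt v x with v ≟ B
  ... | yes _ = next³≡id x
  ... | no _  = refl

  nextAt-self : ∀ x → nextAt B x ≡ next x
  nextAt-self x with B ≟ B
  ... | yes _ = refl
  ... | no B≢B = ⊥-elim (B≢B refl)

  nextAt-other : ∀ {v} → v ≢ B → ∀ x → nextAt v x ≡ x
  nextAt-other {v} v≢B x with v ≟ B
  ... | yes v≡B = ⊥-elim (v≢B v≡B)
  ... | no _ = refl

winsWithHintNeq⇒winsWithHintEq : ∀ {n} (G : Graph n) {A B : Fin n} → A ≢ B →
  WinsWithHintNeq G A B → WinsWithHintEq G A B
winsWithHintNeq⇒winsWithHintEq G {A} {B} A≢B (f , wins) =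
  relabelStrategy G (nextAt B) (prevAt B) (prevAt∘nextAt B) f ,
  λ C CA≡CB → someoneCorrect-relabel G (nextAt B) (prevAt B) (prevAt∘nextAt B) f C
    (wins _ (λ e → x≢next-x (C B) (begin
      C B                 ≡⟨ sym CA≡CB ⟩
      C A                 ≡⟨ sym (nextAt-other B A≢B (C A)) ⟩
      nextAt B A (C A)    ≡⟨ e ⟩
      nextAt B B (C B)    ≡⟨ nextAt-self B (C B) ⟩
      next (C B)          ∎)))
  where open ≡-Reasoning

lemma8 : (m : ℕ) →
    WinsWithHintNeq (Path (suc (suc m))) zero (fromℕ (suc m))
    × WinsWithHintEq (Path (suc (suc m))) zero (fromℕ (suc m))
lemma8 m = path-winsWithHintNeq m
         , winsWithHintNeq⇒winsWithHintEq (Path (suc (suc m))) 0≢1+n (path-winsWithHintNeq m)
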